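{- Let $G=(V,E)$ be an $s$-connector and let $\mathcal{G}$ be a proper acyclic $q$-colouring of $G$. Then $\mathcal{C}(\mathcal{G})$ has at most one edge of size greater than $s+1$.
   Context: A graph $G=(V,E)$ is an $s$-connector if $E$ contains an edge between $X$ and $Y$ for every pair of disjoint $X,Y\subseteq V$ with $|X|,|Y|\ge s$. A $q$-colouring of $G$ is a sequence $\mathcal{G}=(G_0,G_1,\dots,G_q)$ of simple graphs $G_j=(V,E_j)$ with $\bigcup_{j=0}^qE_j=E$. It is $S$-proper ($S\subseteq V$) if $E_0$ equals the set of edges of $G$ with an endpoint in $S$ and $E_0$ is disjoint from $E_1,\dots,E_q$; proper if $S$-proper for some $S$. $\mathcal{C}(\mathcal{G})$ is the multi-hypergraph on $V$ whose edges are the vertex sets of all connected components of $G_1,\dots,G_q$. A hypergraph is a hyperforest if its vertex–edge incidence bipartite graph (joining $u$ to $S$ iff $u\in S$) has no cycles; $\mathcal{G}$ is acyclic if $\mathcal{C}(\mathcal{G})$ is a hyperforest. -}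

module Defs where

open import Data.Nat using (ℕ; zero; suc; _+_; _<_; _≤_)
open import Data.Fin using (Fin; zero; suc; inject₁; fromℕ)
open import Data.Fin.Subset using (Subset; _∈_; _∉_; ∣_∣)
open import Data.Product using (Σ; ∃; ∃-syntax; _×_; _,_)
open import Data.Sum using (_⊎_)
open import Relation.Nullary using (¬_)
open import Relation.Binary.PropositionalEquality using (_≡_)
open import Relation.Binary.Construct.Closure.ReflexiveTransitive using (Star)
open import Function.Bundles using (_⇔_)
open import Function.Definitions using (Injective)

record Graph (n : ℕ) : Set₁ where
  field
    Adj   : Fin n → Fin n → Set
    sym   : ∀ {u v} → Adj u v → Adj v u
    irrefl : ∀ {u} → ¬ Adj u u
open Graph public

Disjoint : ∀ {n} → Subset n → Subset n → Set
Disjoint X Y = ∀ v → v ∈ X → v ∉ Y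

IsConnector : ∀ {n} → ℕ → Graph n → Set
IsConnector {n} s G =
  (X Y : Subset n) → Disjoint X Y → s ≤ ∣ X ∣ → s ≤ ∣ Y ∣ →
  ∃[ x ] ∃[ y ] (x ∈ X × y ∈ Y × Adj G x y)

-- A q-colouring (G_0,...,G_q) of G: colour j is the graph (𝒢 j),
-- and the union of the edge sets of all G_j is E.
IsColouring : ∀ {n} (q : ℕ) → Graph n → (Fin (suc q) → Graph n) → Set
IsColouring {n} q G 𝒢 = ∀ (u v : Fin n) → Adj G u v ⇔ (∃[ j ] Adj (𝒢 j) u v)

-- S-proper: E_0 = edges of G with an endpoint in S, and E_0 disjoint from E_1..E_q.
IsSProper : ∀ {n} (q : ℕ) → Graph n → (Fin (suc q) → Graph n) → Subset n → Set
IsSProper {n} q G 𝒢 S =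
  (∀ (u v : Fin n) → Adj (𝒢 zero) u v ⇔ (Adj G u v × (u ∈ S ⊎ v ∈ S))) ×
  (∀ (j : Fin q) (u v : Fin n) → ¬ (Adj (𝒢 zero) u v × Adj (𝒢 (suc j)) u v))

IsProper : ∀ {n} (q : ℕ) → Graph n → (Fin (suc q) → Graph n) → Set
IsProper {n} q G 𝒢 = ∃[ S ] IsSProper q G 𝒢 S

Connected : ∀ {n} → Graph n → Fin n → Fin n → Set
Connected H = Star (Adj H)

IsComponent : ∀ {n} → Graph n → Subset n → Set
IsComponent {n} H C =
  (∃[ v ] v ∈ C) ×
  (∀ u v → u ∈ C → v ∈ C → Connected H u v) ×
  (∀ u v → u ∈ C → Adj H u v → v ∈ C)

-- Multi-hypergraph on Fin n: edges are labelled by L, the predicate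
-- IsEdge says which labels are edges, and vset gives the vertex set.
record MultiHypergraph (n : ℕ) : Set₁ where
  field
    Label  : Set
    IsEdge : Label → Set
    vset   : Label → Subset n
open MultiHypergraph public

-- 𝒞(𝒢): edges are labelled by pairs (j, C) with j ∈ {1..q} and C the
-- vertex set of a component of G_j (distinct colours give distinct edges).
𝒞 : ∀ {n} (q : ℕ) → (Fin (suc q) → Graph n) → MultiHypergraph n
𝒞 {n} q 𝒢 = record
  { Label  = Fin q × Subset n
  ; IsEdge = λ { (j , C) → IsComponent (𝒢 (suc j)) C }
  ; vset   = λ { (j , C) → C }
  }

-- A cycle in the vertex–edge incidence bipartite graph of ℋ:
-- distinct vertices v_0..v_m and distinct edges e_0..e_m (m ≥ 1, so length ≥ 4),
-- with v_i ∈ e_i, v_{i+1} ∈ e_i, and v_0 ∈ e_m.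
record IncidenceCycle {n : ℕ} (ℋ : MultiHypergraph n) : Set where
  field
    m      : ℕ
    m≥1    : 1 ≤ m
    vs     : Fin (suc m) → Fin n
    es     : Fin (suc m) → Label ℋ
    vs-inj : Injective _≡_ _≡_ vs
    es-inj : Injective _≡_ _≡_ es
    es-edge : ∀ i → IsEdge ℋ (es i)
    here   : ∀ i → vs i ∈ vset ℋ (es i)
    next   : ∀ (i : Fin m) → vs (suc i) ∈ vset ℋ (es (inject₁ i))
    close  : vs zero ∈ vset ℋ (es (fromℕ m))

IsHyperforest : ∀ {n} → MultiHypergraph n → Set
IsHyperforest ℋ = ¬ IncidenceCycle ℋ

IsAcyclic : ∀ {n} (q : ℕ) → (Fin (suc q) → Graph n) → Set
IsAcyclic q 𝒢 = IsHyperforest (𝒞 q 𝒢)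

AtMostOneEdgeLargerThan : ∀ {n} → ℕ → MultiHypergraph n → Set
AtMostOneEdgeLargerThan t ℋ =
  ∀ e f → IsEdge ℋ e → IsEdge ℋ f →
  t < ∣ vset ℋ e ∣ → t < ∣ vset ℋ f ∣ → e ≡ f

{-# OPTIONS --safe #-}

-- In a hyperforest two distinct edges share at most one vertex. So if C ≠ D are edges
-- of 𝒞(𝒢) with more than s + 1 vertices, both C ∖ D and D ∖ C have more than s vertices,
-- and the connector property, applied twice, gives two disjoint edges x₁y₁, x₂y₂ of G
-- with xᵢ ∈ C ∖ D and yᵢ ∈ D ∖ C. Vertices of components with at least two vertices
-- avoid S, so these edges have a colour ≥ 1 and lie in hyperedges e₁, e₂ of 𝒞(𝒢);
-- then x₁ e₁ y₁ D y₂ e₂ x₂ C is a cycle in the incidence graph.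

module Submission where

open import Defs
import Data.Bool as Bool
open import Data.Empty using (⊥)
open import Data.Fin using (Fin; zero; suc; inject₁; fromℕ; _≟_)
open import Data.Fin.Properties using (suc-injective; 0≢1+n; sequence)
open import Data.Fin.Subset
  using (Subset; _∈_; _∉_; ∣_∣; _─_; _∩_; ⁅_⁆; inside; outside; Nonempty)
open import Data.Fin.Subset.Properties
  using (x∈p∩q⁻; p─q⊆p; ∣p∩q∣≤∣q∣; ∣⁅x⁆∣≡1; x∉⁅y⁆⇒x≢y; Empty-unique; ∣⊥∣≡0)
open import Data.Nat using (ℕ; suc; _+_; _≤_; _<_; z≤n; s≤s)
open import Data.Nat.Properties
  using (+-suc; +-comm; +-cancelʳ-≤; +-monoʳ-≤; ≤-trans; ≤-reflexive; m≤n+m; <⇒≤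
        ; module ≤-Reasoning)
open import Data.Product using (∃-syntax; _×_; _,_; proj₁; proj₂)
import Data.Product as Product
import Data.Product.Properties as Product
open import Data.Sum using (inj₁; inj₂)
open import Data.Vec using (Vec; []; _∷_; here; there; lookup; tabulate)
import Data.Vec.Properties as Vec
open import Data.Vec.Relation.Unary.Unique.Propositional using (Unique)
open import Data.Vec.Relation.Unary.Unique.Propositional.Properties using (lookup-injective)
open import Data.Vec.Relation.Unary.All using ([]; _∷_)
open import Data.Vec.Relation.Unary.AllPairs using ([]; _∷_)
open import Effect.Monad using (RawMonad)
open import Function.Base using (_∘_)
open import Function.Bundles using (Equivalence)
open import Level using (0ℓ)
open import Relation.Binary.PropositionalEquality
  using (_≡_; _≢_; refl; trans; cong; subst; ≢-sym) renaming (sym to ≡-sym)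
open import Relation.Binary.Construct.Closure.ReflexiveTransitive
  using (Star; ε; _◅_; _◅◅_; reverse)
open import Relation.Nullary using (¬_; yes; no; does; contradiction)
open import Relation.Nullary.Decidable using (decidable-stable; dec-true; ¬¬-excluded-middle)
open import Relation.Nullary.Negation using (¬¬-Monad; ¬¬-map)
open import Relation.Unary using (Pred; Decidable)
open Equivalence using (to; from)

private
  variable
    n : ℕ

∣p∣≡∣p─q∣+∣p∩q∣ : (p q : Subset n) → ∣ p ∣ ≡ ∣ p ─ q ∣ + ∣ p ∩ q ∣
∣p∣≡∣p─q∣+∣p∩q∣ []            []            = refl
∣p∣≡∣p─q∣+∣p∩q∣ (inside  ∷ p) (inside  ∷ q) =
  trans (cong suc (∣p∣≡∣p─q∣+∣p∩q∣ p q)) (≡-sym (+-suc ∣ p ─ q ∣ ∣ p ∩ q ∣))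
∣p∣≡∣p─q∣+∣p∩q∣ (inside  ∷ p) (outside ∷ q) = cong suc (∣p∣≡∣p─q∣+∣p∩q∣ p q)
∣p∣≡∣p─q∣+∣p∩q∣ (outside ∷ p) (inside  ∷ q) = ∣p∣≡∣p─q∣+∣p∩q∣ p q
∣p∣≡∣p─q∣+∣p∩q∣ (outside ∷ p) (outside ∷ q) = ∣p∣≡∣p─q∣+∣p∩q∣ p q

∣p∩q∣≤k⇒k+t≤∣p∣⇒t≤∣p─q∣ : (p q : Subset n) {k t : ℕ} →
  ∣ p ∩ q ∣ ≤ k → k + t ≤ ∣ p ∣ → t ≤ ∣ p ─ q ∣
∣p∩q∣≤k⇒k+t≤∣p∣⇒t≤∣p─q∣ p q {k} {t} ∣p∩q∣≤k k+t≤∣p∣ = +-cancelʳ-≤ k t ∣ p ─ q ∣ (begin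
  t + k               ≡⟨ +-comm t k ⟩
  k + t               ≤⟨ k+t≤∣p∣ ⟩
  ∣ p ∣               ≡⟨ ∣p∣≡∣p─q∣+∣p∩q∣ p q ⟩
  ∣ p ─ q ∣ + ∣ p ∩ q ∣ ≤⟨ +-monoʳ-≤ ∣ p ─ q ∣ ∣p∩q∣≤k ⟩
  ∣ p ─ q ∣ + k       ∎)
  where open ≤-Reasoning

t<∣p∣⇒t≤∣p─⁅x⁆∣ : (p : Subset n) (x : Fin n) {t : ℕ} → t < ∣ p ∣ → t ≤ ∣ p ─ ⁅ x ⁆ ∣
t<∣p∣⇒t≤∣p─⁅x⁆∣ p x = ∣p∩q∣≤k⇒k+t≤∣p∣⇒t≤∣p─q∣ p ⁅ x ⁆
  (≤-trans (∣p∩q∣≤∣q∣ p ⁅ x ⁆) (≤-reflexive (∣⁅x⁆∣≡1 x)))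

x∈p─q⇒x∉q : {p q : Subset n} {x : Fin n} → x ∈ p ─ q → x ∉ q
x∈p─q⇒x∉q {p = inside ∷ p} {outside ∷ q} here = λ ()
x∈p─q⇒x∉q {p = _ ∷ p}      {_ ∷ q}       (there x∈p─q) (there x∈q) = x∈p─q⇒x∉q x∈p─q x∈q

1≤∣p∣⇒Nonempty : {p : Subset n} → 1 ≤ ∣ p ∣ → Nonempty p
1≤∣p∣⇒Nonempty {p = inside  ∷ p} _      = zero , here
1≤∣p∣⇒Nonempty {p = outside ∷ p} 1≤∣p∣ = Product.map suc there (1≤∣p∣⇒Nonempty 1≤∣p∣)

subsingleton⇒∣p∣≤1 : {p : Subset n} → (∀ {u v} → u ∈ p → v ∈ p → u ≡ v) → ∣ p ∣ ≤ 1
subsingleton⇒∣p∣≤1 {p = []}          _        = z≤n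
subsingleton⇒∣p∣≤1 {p = outside ∷ p} p-unique =
  subsingleton⇒∣p∣≤1 λ u∈p v∈p → suc-injective (p-unique (there u∈p) (there v∈p))
subsingleton⇒∣p∣≤1 {n = suc m} {p = inside  ∷ p} p-unique =
  s≤s (≤-reflexive (trans (cong ∣_∣ (Empty-unique p-empty)) (∣⊥∣≡0 m)))
  where
  p-empty : ¬ Nonempty p
  p-empty (v , v∈p) = 0≢1+n (p-unique here (there v∈p))

x∈p∧y∉p⇒x≢y : {p : Subset n} {x y : Fin n} → x ∈ p → y ∉ p → x ≢ y
x∈p∧y∉p⇒x≢y x∈p y∉p refl = y∉p x∈p

fromDec : {P : Pred (Fin n) 0ℓ} → Decidable P → Subset n
fromDec P? = tabulate (does ∘ P?)

module _ {P : Pred (Fin n) 0ℓ} (P? : Decidable P) where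

  ∈-fromDec⁺ : ∀ {v} → P v → v ∈ fromDec P?
  ∈-fromDec⁺ {v} Pv =
    Vec.lookup⇒[]= v (fromDec P?) (trans (Vec.lookup∘tabulate _ v) (dec-true (P? v) Pv))

  ∈-fromDec⁻ : ∀ {v} → v ∈ fromDec P? → P v
  ∈-fromDec⁻ {v} v∈ with P? v | trans (≡-sym (Vec.lookup∘tabulate _ v)) (Vec.[]=⇒lookup v∈)
  ... | yes Pv | _  = Pv
  ... | no  _  | ()

first-step : ∀ {A : Set} {R : A → A → Set} {x y : A} → Star R x y → x ≢ y → ∃[ z ] R x z
first-step ε         x≢x = contradiction refl x≢x
first-step (r ◅ _) _   = _ , r

module _ (H : Graph n) where

  nontrivial-component⇒neighbour : ∀ {C x} → IsComponent H C → 2 ≤ ∣ C ∣ → x ∈ C → ∃[ y ] Adj H x y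
  nontrivial-component⇒neighbour {C} {x} (_ , C-connected , _) 2≤∣C∣ x∈C =
    let y , y∈C─x = 1≤∣p∣⇒Nonempty (t<∣p∣⇒t≤∣p─⁅x⁆∣ C x 2≤∣C∣)
    in first-step (C-connected x y x∈C (p─q⊆p C ⁅ x ⁆ y∈C─x))
                  (≢-sym (x∉⁅y⁆⇒x≢y (x∈p─q⇒x∉q y∈C─x)))

  -- Adjacency is not assumed decidable, so the component of a vertex exists only
  -- up to double negation (excluded middle for each of the finitely many vertices).
  component-of : (x : Fin n) → ¬ ¬ (∃[ K ] (IsComponent H K × (∀ {v} → Connected H x v → v ∈ K)))
  component-of x = ¬¬-map component-from-decider
    (sequence (RawMonad.rawApplicative ¬¬-Monad) λ v → ¬¬-excluded-middle)
    where
    component-from-decider : Decidable (Connected H x) →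
      ∃[ K ] (IsComponent H K × (∀ {v} → Connected H x v → v ∈ K))
    component-from-decider reachable? = K , K-component , ∈-fromDec⁺ reachable?
      where
      K = fromDec reachable?
      K-component : IsComponent H K
      K-component =
          (x , ∈-fromDec⁺ reachable? ε)
        , (λ u v u∈K v∈K →
             reverse (Graph.sym H) (∈-fromDec⁻ reachable? u∈K) ◅◅ ∈-fromDec⁻ reachable? v∈K)
        , (λ u v u∈K uv → ∈-fromDec⁺ reachable? (∈-fromDec⁻ reachable? u∈K ◅◅ (uv ◅ ε)))

  edge⇒component : ∀ {x y} → Adj H x y → ¬ ¬ (∃[ K ] (IsComponent H K × x ∈ K × y ∈ K))
  edge⇒component {x} xy =
    ¬¬-map (λ (K , K-component , reach⊆K) → K , K-component , reach⊆K ε , reach⊆K (xy ◅ ε))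
           (component-of x)

module Hypergraph (ℋ : MultiHypergraph n) where

  _∈ₑ_ : Fin n → Label ℋ → Set
  v ∈ₑ e = v ∈ vset ℋ e

  v∈e∧v∉f⇒e≢f : ∀ {v e f} → v ∈ₑ e → ¬ v ∈ₑ f → e ≢ f
  v∈e∧v∉f⇒e≢f v∈e v∉f refl = v∉f v∈e

  incidenceCycle : ∀ {m} (vs : Vec (Fin n) (2 + m)) (es : Vec (Label ℋ) (2 + m)) →
    Unique vs → Unique es → (∀ i → IsEdge ℋ (lookup es i)) →
    (∀ i → lookup vs i ∈ₑ lookup es i) →
    (∀ i → lookup vs (suc i) ∈ₑ lookup es (inject₁ i)) →
    lookup vs zero ∈ₑ lookup es (fromℕ (suc m)) →
    IncidenceCycle ℋ
  incidenceCycle {m} vs es vs-unique es-unique es-edge incident incident-next incident-last = record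
    { m       = suc m
    ; m≥1     = s≤s z≤n
    ; vs      = lookup vs
    ; es      = lookup es
    ; vs-inj  = lookup-injective vs-unique _ _
    ; es-inj  = lookup-injective es-unique _ _
    ; es-edge = es-edge
    ; here    = incident
    ; next    = incident-next
    ; close   = incident-last
    }

  module _ (forest : IsHyperforest ℋ) where

    hyperforest⇒linear : ∀ {e f u v} → IsEdge ℋ e → IsEdge ℋ f → e ≢ f →
      u ∈ₑ e → v ∈ₑ e → u ∈ₑ f → v ∈ₑ f → u ≡ v
    hyperforest⇒linear {e} {f} {u} {v} e-edge f-edge e≢f u∈e v∈e u∈f v∈f =
      decidable-stable (u ≟ v) λ u≢v →
        forest (incidenceCycle (u ∷ v ∷ []) (e ∷ f ∷ [])
          ((u≢v ∷ []) ∷ [] ∷ []) ((e≢f ∷ []) ∷ [] ∷ [])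
          (λ { zero → e-edge ; (suc zero) → f-edge })
          (λ { zero → u∈e ; (suc zero) → v∈f })
          (λ { zero → v∈e })
          u∈f)

    hyperforest⇒∣e∩f∣≤1 : ∀ {e f} → IsEdge ℋ e → IsEdge ℋ f → e ≢ f → ∣ vset ℋ e ∩ vset ℋ f ∣ ≤ 1
    hyperforest⇒∣e∩f∣≤1 {e} {f} e-edge f-edge e≢f = subsingleton⇒∣p∣≤1 λ u∈e∩f v∈e∩f →
      let u∈e , u∈f = x∈p∩q⁻ (vset ℋ e) (vset ℋ f) u∈e∩f
          v∈e , v∈f = x∈p∩q⁻ (vset ℋ e) (vset ℋ f) v∈e∩f
      in hyperforest⇒linear e-edge f-edge e≢f u∈e v∈e u∈f v∈f

    hyperforest⇒t<∣e∣⇒t≤∣e─f∣ : ∀ {e f t} → IsEdge ℋ e → IsEdge ℋ f → e ≢ f →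
      t < ∣ vset ℋ e ∣ → t ≤ ∣ vset ℋ e ─ vset ℋ f ∣
    hyperforest⇒t<∣e∣⇒t≤∣e─f∣ {e} {f} e-edge f-edge e≢f =
      ∣p∩q∣≤k⇒k+t≤∣p∣⇒t≤∣p─q∣ (vset ℋ e) (vset ℋ f) (hyperforest⇒∣e∩f∣≤1 e-edge f-edge e≢f)

    hyperforest⇒¬crossing-pair : ∀ {e f e₁ e₂ x₁ x₂ y₁ y₂} →
      IsEdge ℋ e → IsEdge ℋ f → e ≢ f → IsEdge ℋ e₁ → IsEdge ℋ e₂ →
      x₁ ∈ vset ℋ e ─ vset ℋ f → x₂ ∈ vset ℋ e ─ vset ℋ f → x₁ ≢ x₂ →
      y₁ ∈ vset ℋ f ─ vset ℋ e → y₂ ∈ vset ℋ f ─ vset ℋ e → y₁ ≢ y₂ →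
      x₁ ∈ₑ e₁ → y₁ ∈ₑ e₁ → x₂ ∈ₑ e₂ → y₂ ∈ₑ e₂ → ⊥
    hyperforest⇒¬crossing-pair {e} {f} {e₁} {e₂} {x₁} {x₂} {y₁} {y₂}
      e-edge f-edge e≢f e₁-edge e₂-edge x₁∈e─f x₂∈e─f x₁≢x₂ y₁∈f─e y₂∈f─e y₁≢y₂
      x₁∈e₁ y₁∈e₁ x₂∈e₂ y₂∈e₂ =
      forest (incidenceCycle (x₁ ∷ y₁ ∷ y₂ ∷ x₂ ∷ []) (e₁ ∷ f ∷ e₂ ∷ e ∷ [])
        (   (x∈p∧y∉p⇒x≢y x₁∈e y₁∉e ∷ x∈p∧y∉p⇒x≢y x₁∈e y₂∉e ∷ x₁≢x₂ ∷ [])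
          ∷ (y₁≢y₂ ∷ x∈p∧y∉p⇒x≢y y₁∈f x₂∉f ∷ [])
          ∷ (x∈p∧y∉p⇒x≢y y₂∈f x₂∉f ∷ [])
          ∷ [] ∷ [])
        (   (v∈e∧v∉f⇒e≢f x₁∈e₁ x₁∉f ∷ e₁≢e₂ ∷ v∈e∧v∉f⇒e≢f y₁∈e₁ y₁∉e ∷ [])
          ∷ (≢-sym (v∈e∧v∉f⇒e≢f x₂∈e₂ x₂∉f) ∷ ≢-sym e≢f ∷ [])
          ∷ (v∈e∧v∉f⇒e≢f y₂∈e₂ y₂∉e ∷ [])
          ∷ [] ∷ [])
        (λ { zero → e₁-edge ; (suc zero) → f-edge ; (suc (suc zero)) → e₂-edge
           ; (suc (suc (suc zero))) → e-edge })
        (λ { zero → x₁∈e₁ ; (suc zero) → y₁∈f ; (suc (suc zero)) → y₂∈e₂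
           ; (suc (suc (suc zero))) → x₂∈e })
        (λ { zero → y₁∈e₁ ; (suc zero) → y₂∈f ; (suc (suc zero)) → x₂∈e₂ })
        x₁∈e)
      where
      x₁∈e = p─q⊆p (vset ℋ e) (vset ℋ f) x₁∈e─f
      x₂∈e = p─q⊆p (vset ℋ e) (vset ℋ f) x₂∈e─f
      y₁∈f = p─q⊆p (vset ℋ f) (vset ℋ e) y₁∈f─e
      y₂∈f = p─q⊆p (vset ℋ f) (vset ℋ e) y₂∈f─e
      x₁∉f = x∈p─q⇒x∉q x₁∈e─f
      x₂∉f = x∈p─q⇒x∉q x₂∈e─f
      y₁∉e = x∈p─q⇒x∉q y₁∈f─e
      y₂∉e = x∈p─q⇒x∉q y₂∈f─e
      e₁≢e₂ : e₁ ≢ e₂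
      e₁≢e₂ refl = x₁≢x₂
        (hyperforest⇒linear e₁-edge e-edge (v∈e∧v∉f⇒e≢f y₁∈e₁ y₁∉e) x₁∈e₁ x₂∈e₂ x₁∈e x₂∈e)

record IndependentEdgePair (G : Graph n) (X Y : Subset n) : Set where
  field
    x₁ x₂ y₁ y₂ : Fin n
    x₁∈X : x₁ ∈ X
    x₂∈X : x₂ ∈ X
    y₁∈Y : y₁ ∈ Y
    y₂∈Y : y₂ ∈ Y
    x₁≢x₂ : x₁ ≢ x₂
    y₁≢y₂ : y₁ ≢ y₂
    x₁y₁ : Adj G x₁ y₁
    x₂y₂ : Adj G x₂ y₂

Disjoint-─ : {X Y : Subset n} (P Q : Subset n) → Disjoint X Y → Disjoint (X ─ P) (Y ─ Q)
Disjoint-─ {X = X} {Y} P Q X∩Y=∅ v v∈X─P v∈Y─Q = X∩Y=∅ v (p─q⊆p X P v∈X─P) (p─q⊆p Y Q v∈Y─Q)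

connector⇒independentEdgePair : ∀ {s} {G : Graph n} {X Y} → IsConnector s G →
  Disjoint X Y → s < ∣ X ∣ → s < ∣ Y ∣ → IndependentEdgePair G X Y
connector⇒independentEdgePair {G = G} {X} {Y} connector X∩Y=∅ s<∣X∣ s<∣Y∣ =
  let x₁ , y₁ , x₁∈X , y₁∈Y , x₁y₁ = connector X Y X∩Y=∅ (<⇒≤ s<∣X∣) (<⇒≤ s<∣Y∣)
      x₂ , y₂ , x₂∈X′ , y₂∈Y′ , x₂y₂ =
        connector (X ─ ⁅ x₁ ⁆) (Y ─ ⁅ y₁ ⁆) (Disjoint-─ ⁅ x₁ ⁆ ⁅ y₁ ⁆ X∩Y=∅)
          (t<∣p∣⇒t≤∣p─⁅x⁆∣ X x₁ s<∣X∣) (t<∣p∣⇒t≤∣p─⁅x⁆∣ Y y₁ s<∣Y∣)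
  in record
    { x₁∈X = x₁∈X ; x₂∈X = p─q⊆p X ⁅ x₁ ⁆ x₂∈X′
    ; y₁∈Y = y₁∈Y ; y₂∈Y = p─q⊆p Y ⁅ y₁ ⁆ y₂∈Y′
    ; x₁≢x₂ = ≢-sym (x∉⁅y⁆⇒x≢y (x∈p─q⇒x∉q x₂∈X′))
    ; y₁≢y₂ = ≢-sym (x∉⁅y⁆⇒x≢y (x∈p─q⇒x∉q y₂∈Y′))
    ; x₁y₁ = x₁y₁ ; x₂y₂ = x₂y₂
    }

module ProperColouring {q} (G : Graph n) (𝒢 : Fin (suc q) → Graph n) {S : Subset n}
         (colouring : IsColouring q G 𝒢) (proper : IsSProper q G 𝒢 S) where

  open Hypergraph (𝒞 q 𝒢) using (_∈ₑ_)

  coloured-edge⇒∉S : ∀ {j x y} → Adj (𝒢 (suc j)) x y → x ∉ S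
  coloured-edge⇒∉S {j} {x} {y} xy x∈S = proj₂ proper j x y (xy-in-colour-0 , xy)
    where
    xy-in-colour-0 = from (proj₁ proper x y) (from (colouring x y) (suc j , xy) , inj₁ x∈S)

  nontrivial-component⇒∉S : ∀ {j C x} → IsComponent (𝒢 (suc j)) C → 2 ≤ ∣ C ∣ → x ∈ C → x ∉ S
  nontrivial-component⇒∉S {j} C-component 2≤∣C∣ x∈C =
    coloured-edge⇒∉S (proj₂ (nontrivial-component⇒neighbour (𝒢 (suc j)) C-component 2≤∣C∣ x∈C))

  edge-outside-S⇒positive-colour : ∀ {x y} → x ∉ S → y ∉ S → Adj G x y → ∃[ i ] Adj (𝒢 (suc i)) x y
  edge-outside-S⇒positive-colour {x} {y} x∉S y∉S xy with to (colouring x y) xy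
  ... | suc i , xy∈𝒢ᵢ = i , xy∈𝒢ᵢ
  ... | zero  , xy∈𝒢₀ with to (proj₁ proper x y) xy∈𝒢₀
  ...   | _ , inj₁ x∈S = contradiction x∈S x∉S
  ...   | _ , inj₂ y∈S = contradiction y∈S y∉S

  edge-outside-S⇒in-𝒞-edge : ∀ {x y} → x ∉ S → y ∉ S → Adj G x y →
    ¬ ¬ (∃[ e ] (IsEdge (𝒞 q 𝒢) e × x ∈ₑ e × y ∈ₑ e))
  edge-outside-S⇒in-𝒞-edge x∉S y∉S xy =
    let i , xy∈𝒢ᵢ = edge-outside-S⇒positive-colour x∉S y∉S xy
    in ¬¬-map (λ (K , K-component , x∈K , y∈K) → (i , K) , K-component , x∈K , y∈K)
              (edge⇒component (𝒢 (suc i)) xy∈𝒢ᵢ)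

module _ {s q} (G : Graph n) (𝒢 : Fin (suc q) → Graph n) {S : Subset n}
         (connector : IsConnector s G) (colouring : IsColouring q G 𝒢)
         (proper : IsSProper q G 𝒢 S) (acyclic : IsAcyclic q 𝒢) where

  open Hypergraph (𝒞 q 𝒢)
  open ProperColouring G 𝒢 colouring proper

  large-edges-not-distinct : ∀ {e f} → IsEdge (𝒞 q 𝒢) e → IsEdge (𝒞 q 𝒢) f →
    s + 1 < ∣ vset (𝒞 q 𝒢) e ∣ → s + 1 < ∣ vset (𝒞 q 𝒢) f ∣ → ¬ e ≢ f
  large-edges-not-distinct {j , C} {k , D} C-edge D-edge C-large D-large C≢D =
    edge-outside-S⇒in-𝒞-edge (X∩S=∅ x₁∈X) (Y∩S=∅ y₁∈Y) x₁y₁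
      λ (e₁ , e₁-edge , x₁∈e₁ , y₁∈e₁) →
    edge-outside-S⇒in-𝒞-edge (X∩S=∅ x₂∈X) (Y∩S=∅ y₂∈Y) x₂y₂
      λ (e₂ , e₂-edge , x₂∈e₂ , y₂∈e₂) →
    hyperforest⇒¬crossing-pair acyclic C-edge D-edge C≢D e₁-edge e₂-edge
      x₁∈X x₂∈X x₁≢x₂ y₁∈Y y₂∈Y y₁≢y₂ x₁∈e₁ y₁∈e₁ x₂∈e₂ y₂∈e₂
    where
    X = C ─ D
    Y = D ─ C

    2≤∣_∣ : ∀ {m} → s + 1 < m → 2 ≤ m
    2≤∣ large ∣ = ≤-trans (s≤s (m≤n+m 1 s)) large

    X∩S=∅ : ∀ {x} → x ∈ X → x ∉ S
    X∩S=∅ = nontrivial-component⇒∉S C-edge 2≤∣ C-large ∣ ∘ p─q⊆p C D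

    Y∩S=∅ : ∀ {y} → y ∈ Y → y ∉ S
    Y∩S=∅ = nontrivial-component⇒∉S D-edge 2≤∣ D-large ∣ ∘ p─q⊆p D C

    s<∣X∣ : s < ∣ X ∣
    s<∣X∣ = subst (_≤ ∣ X ∣) (+-comm s 1)
      (hyperforest⇒t<∣e∣⇒t≤∣e─f∣ acyclic C-edge D-edge C≢D C-large)

    s<∣Y∣ : s < ∣ Y ∣
    s<∣Y∣ = subst (_≤ ∣ Y ∣) (+-comm s 1)
      (hyperforest⇒t<∣e∣⇒t≤∣e─f∣ acyclic D-edge C-edge (≢-sym C≢D) D-large)

    open IndependentEdgePair (connector⇒independentEdgePair {G = G} {X} {Y} connector
      (λ v v∈X v∈Y → x∈p─q⇒x∉q {p = D} v∈Y (p─q⊆p C D v∈X)) s<∣X∣ s<∣Y∣)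

corollary3p5 : ∀ (n s q : ℕ) (G : Graph n) (𝒢 : Fin (suc q) → Graph n) →
    IsConnector s G → IsColouring q G 𝒢 → IsProper q G 𝒢 → IsAcyclic q 𝒢 →
    AtMostOneEdgeLargerThan (s + 1) (𝒞 q 𝒢)
corollary3p5 n s q G 𝒢 connector colouring (S , proper) acyclic e f e-edge f-edge e-large f-large =
  decidable-stable (Product.≡-dec _≟_ (Vec.≡-dec Bool._≟_) e f)
    (large-edges-not-distinct G 𝒢 connector colouring proper acyclic e-edge f-edge e-large f-large)
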